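{- The Thue–Morse word $\mathbf t$ is uniformly abelian-square-rich.
   Context: The Thue–Morse word $\mathbf t=0110100110010110\cdots$ is the fixed point starting with $0$ of the morphism $\mu:0\mapsto 01,\ 1\mapsto 10$. An abelian square is a nonempty word $uv$ where $v$ is an anagram of $u$. For a finite word $v$, $\mathrm{AS}(v)$ is the number of distinct factors of $v$ that are abelian squares. An infinite word $w$ is uniformly abelian-square-rich if there exist $C>0$ and an integer $n_0$ such that $\mathrm{AS}(v)\ge C|v|^2$ for every factor $v$ of $w$ with $|v|\ge n_0$. -}

module Defs where

open import Data.Bool using (Bool; true; false; not; _∧_; if_then_else_)
import Data.Bool as B
open import Data.Nat using (ℕ; zero; suc; _+_; _*_; _^_)
import Data.Nat as N
open import Data.List using (List; []; _∷_; concatMap; length; take; drop; filter; deduplicate; upTo)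
open import Data.List.Properties using (≡-dec)
open import Data.Maybe using (Maybe; just; nothing)
open import Relation.Nullary.Decidable using (Dec; yes; no; ⌊_⌋)
open import Data.Integer using (+_)
open import Data.Rational using (ℚ; _/_)
import Data.Rational as Q

-- Letters: false = 0, true = 1.  Finite words are lists of letters.
Word : Set
Word = List Bool

μ : Bool → Word
μ b = b ∷ not b ∷ []

μ* : Word → Word
μ* = concatMap μ

μ^ : ℕ → Word
μ^ zero    = false ∷ []
μ^ (suc k) = μ* (μ^ k)

-- safe indexing with a default (never used: |μ^(n+1)(0)| = 2^(n+1) > n)
at : Word → ℕ → Bool
at []       _       = false
at (x ∷ _)  zero    = x
at (_ ∷ xs) (suc n) = at xs n

-- The Thue–Morse word t = lim μ^k(0), the fixed point of μ starting with 0: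
-- its n-th letter (0-indexed) is the n-th letter of the prefix μ^(n+1)(0).
t : ℕ → Bool
t n = at (μ^ (suc n)) n

factorAt : ℕ → ℕ → Word
factorAt i zero    = []
factorAt i (suc n) = t i ∷ factorAt (suc i) n

IsFactorOfT : Word → Set
IsFactorOfT v = Data.Product.∃ λ i → factorAt i (length v) Relation.Binary.PropositionalEquality.≡ v
  where import Data.Product
        import Relation.Binary.PropositionalEquality

occ : Bool → Word → ℕ
occ a [] = zero
occ a (b ∷ w) = (if ⌊ a B.≟ b ⌋ then 1 else 0) + occ a w

anagram? : Word → Word → Bool
anagram? u v = ⌊ occ false u N.≟ occ false v ⌋ ∧ ⌊ occ true u N.≟ occ true v ⌋

-- w is an abelian square: w = uv, w nonempty, v an anagram of u.
-- (If w = uv with v an anagram of u then |u| = |v| = |w|/2.)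
isAbSq : Word → Bool
isAbSq w with length w N.% 2
... | zero  = ⌊ 1 N.≤? length w ⌋ ∧ anagram? (take (length w N./ 2) w) (drop (length w N./ 2) w)
... | suc _ = false

factors : Word → List Word
factors v = concatMap (λ j → Data.List.map (λ l → take l (drop j v)) (upTo (suc (length v)))) (upTo (suc (length v)))
  where import Data.List

AS : Word → ℕ
AS v = length (filter (λ w → isAbSq w B.≟ true) (deduplicate (≡-dec B._≟_) (factors v)))

ℕ→ℚ : ℕ → ℚ
ℕ→ℚ n = (+ n) / 1

module Submission where

-- A factor starting at an even position 2y with even
--    length 2k consists of k blocks 01/10, so it has k letters of each kind;
--    hence a factor at position 2y of length 4k is an abelian square.
--  * No long periodic windows.  If t(x+p) = t(x) for all x in a window of
--    length 5p (p ≥ 1), then for odd p the recurrences force three equal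
--    consecutive letters, impossible since t(2w) ≠ t(2w+1); for even p the
--    window halves to one of length 5(p/2) with period p/2.  Consequently two
--    factors of length L at distance p with 5p ≤ L are different.
--  * Counting.  In a factor of length n ≥ 20M the M² aligned squares at
--    positions 2(z+a), lengths 4(3M+b), for a, b < M, are pairwise distinct
--    (different b: different lengths; equal b: shift 2d with 10d ≤ 12M).
--    With M = ⌊n/20⌋ we have n ≤ 40M, so n² ≤ 1600·AS(v); a final lemma
--    transports this inequality from ℕ to ℚ.

open import Defs
open import Data.Bool using (true; false; not)
open import Data.Bool.Properties using (not-¬; not-involutive)
import Data.Bool as B
open import Data.Nat hiding (parity)
open import Data.Nat.Properties
open import Data.Nat.DivMod using (_/_; _%_; m≡m%n+[m/n]*n; m%n<n; m*n%n≡0; m*n/n≡m; /-monoˡ-≤)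
open import Data.Nat.Induction using (<-rec)
open import Data.Nat.Tactic.RingSolver using (solve-∀)
open import Data.Fin using (Fin; toℕ; remQuot; combine)
open import Data.Fin.Properties using (toℕ<n; toℕ-injective; combine-remQuot; injective⇒≤)
open import Data.List using (List; []; _∷_; length; take; drop; lookup)
import Data.List as List
open import Data.List.Properties using (≡-dec; ∷-injective)
open import Data.List.Relation.Unary.Any using (index)
open import Data.List.Relation.Unary.Any.Properties using (lookup-index)
open import Data.List.Membership.Propositional using (_∈_; lose)
open import Data.List.Membership.Propositional.Properties
  using (∈-concatMap⁺; ∈-map⁺; ∈-upTo⁺; ∈-filter⁺; ∈-deduplicate⁺)
open import Data.Product using (Σ; ∃; ∃₂; _×_; _,_; proj₁; proj₂; uncurry)
open import Data.Sum using (inj₁; inj₂)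
import Data.Integer as ℤ
import Data.Integer.Properties as ℤₚ
open import Data.Rational using (ℚ; mkℚ; 0ℚ)
import Data.Rational as Q
open import Data.Rational.Properties using (normalize-coprime; toℚᵘ-cancel-≤; toℚᵘ-homo-*)
import Data.Rational.Unnormalised as Qᵘ
import Data.Rational.Unnormalised.Properties as Qᵘₚ
open import Data.Nat.Coprimality using (1-coprimeTo) renaming (sym to coprime-sym)
open import Function.Definitions using (Injective)
open import Relation.Binary.Definitions using (tri<; tri≈; tri>)
open import Relation.Binary.PropositionalEquality
open import Relation.Nullary using (¬_; Dec; yes; no; contradiction)
open import Relation.Nullary.Decidable using (⌊_⌋; dec-true; isYes≗does)

data Parity : ℕ → Set where
  even : ∀ m → Parity (m + m)
  odd  : ∀ m → Parity (suc (m + m))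

parity : ∀ n → Parity n
parity zero = even zero
parity (suc n) with parity n
... | even m = odd m
... | odd m  = subst Parity (cong suc (+-suc m m)) (even (suc m))

roundUpEven : ∀ j → ∃₂ λ z e → e ≤ 1 × j + e ≡ z + z
roundUpEven j with parity j
... | even m = m , 0 , z≤n , +-identityʳ (m + m)
... | odd m  = suc m , 1 , ≤-refl , trans (+-comm (suc (m + m)) 1) (cong suc (sym (+-suc m m)))

halve-< : ∀ {m n} → m + m < n + n → m < n
halve-< {m} {n} lt with m <? n
... | yes m<n = m<n
... | no m≮n  = contradiction lt (≤⇒≯ (+-mono-≤ (≮⇒≥ m≮n) (≮⇒≥ m≮n)))

2^-suc : ∀ k → 2 ^ suc k ≡ 2 ^ k + 2 ^ k
2^-suc k = cong (2 ^ k +_) (+-identityʳ (2 ^ k))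

-- The prefix μ^n(0), of length 2^n, already contains position n.
n<2^n : ∀ n → n < 2 ^ n
n<2^n zero    = z<s
n<2^n (suc n) = subst (suc n <_) (sym (2^-suc n)) (+-mono-≤-< (m^n>0 2 n) (n<2^n n))

length-μ* : ∀ w → length (μ* w) ≡ length w + length w
length-μ* []      = refl
length-μ* (b ∷ w) = cong suc (trans (cong suc (length-μ* w)) (sym (+-suc (length w) (length w))))

length-μ^ : ∀ k → length (μ^ k) ≡ 2 ^ k
length-μ^ zero    = refl
length-μ^ (suc k) = trans (length-μ* (μ^ k)) (trans (cong (λ l → l + l) (length-μ^ k)) (sym (2^-suc k)))

at-μ*-even : ∀ w n → at (μ* w) (n + n) ≡ at w n
at-μ*-even []      n       = refl
at-μ*-even (b ∷ w) zero    = refl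
at-μ*-even (b ∷ w) (suc n) rewrite +-suc n n = at-μ*-even w n

at-μ*-odd : ∀ w n → n < length w → at (μ* w) (suc (n + n)) ≡ not (at w n)
at-μ*-odd (b ∷ w) zero    _        = refl
at-μ*-odd (b ∷ w) (suc n) (s≤s lt) rewrite +-suc n n = at-μ*-odd w n lt

at-μ^-suc : ∀ k n → n < 2 ^ k → at (μ^ (suc k)) n ≡ at (μ^ k) n
at-μ^-suc zero    zero    _          = refl
at-μ^-suc zero    (suc n) (s≤s ())
at-μ^-suc (suc k) n       lt with parity n
... | even m = begin
  at (μ^ (suc (suc k))) (m + m) ≡⟨ at-μ*-even (μ^ (suc k)) m ⟩
  at (μ^ (suc k)) m             ≡⟨ at-μ^-suc k m m<2^k ⟩
  at (μ^ k) m                   ≡⟨ at-μ*-even (μ^ k) m ⟨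
  at (μ^ (suc k)) (m + m)       ∎
  where open ≡-Reasoning
        m<2^k : m < 2 ^ k
        m<2^k = halve-< (subst (m + m <_) (2^-suc k) lt)
... | odd m = begin
  at (μ^ (suc (suc k))) (suc (m + m)) ≡⟨ at-μ*-odd (μ^ (suc k)) m (bound (suc k) (<-≤-trans m<2^k (^-monoʳ-≤ 2 (n≤1+n k)))) ⟩
  not (at (μ^ (suc k)) m)             ≡⟨ cong not (at-μ^-suc k m m<2^k) ⟩
  not (at (μ^ k) m)                   ≡⟨ at-μ*-odd (μ^ k) m (bound k m<2^k) ⟨
  at (μ^ (suc k)) (suc (m + m))       ∎
  where open ≡-Reasoning
        m<2^k : m < 2 ^ k
        m<2^k = halve-< (<-trans (n<1+n (m + m)) (subst (suc (m + m) <_) (2^-suc k) lt))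
        bound : ∀ j → m < 2 ^ j → m < length (μ^ j)
        bound j = subst (m <_) (sym (length-μ^ j))

at-μ^-stable : ∀ {k k'} n → n < 2 ^ k → k ≤′ k' → at (μ^ k') n ≡ at (μ^ k) n
at-μ^-stable n lt ≤′-refl = refl
at-μ^-stable {k} {suc k'} n lt (≤′-step k≤k') =
  trans (at-μ^-suc k' n (<-≤-trans lt (^-monoʳ-≤ 2 (≤′⇒≤ k≤k')))) (at-μ^-stable n lt k≤k')

t-at-μ^ : ∀ k n → n < 2 ^ k → t n ≡ at (μ^ k) n
t-at-μ^ k n lt with ≤-total k (suc n)
... | inj₁ k≤ = at-μ^-stable n lt (≤⇒≤′ k≤)
... | inj₂ ≤k = sym (at-μ^-stable n (<-≤-trans (n<2^n n) (^-monoʳ-≤ 2 (n≤1+n n))) (≤⇒≤′ ≤k))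

t-even : ∀ n → t (n + n) ≡ t n
t-even n = begin
  t (n + n)               ≡⟨ t-at-μ^ (suc n) (n + n) double-bound ⟩
  at (μ^ (suc n)) (n + n) ≡⟨ at-μ*-even (μ^ n) n ⟩
  at (μ^ n) n             ≡⟨ t-at-μ^ n n (n<2^n n) ⟨
  t n                     ∎
  where open ≡-Reasoning
        double-bound : n + n < 2 ^ suc n
        double-bound = subst (n + n <_) (sym (2^-suc n)) (+-mono-< (n<2^n n) (n<2^n n))

t-odd : ∀ n → t (suc (n + n)) ≡ not (t n)
t-odd n = begin
  t (suc (n + n))               ≡⟨ t-at-μ^ (suc n) (suc (n + n)) double-bound ⟩
  at (μ^ (suc n)) (suc (n + n)) ≡⟨ at-μ*-odd (μ^ n) n (subst (n <_) (sym (length-μ^ n)) (n<2^n n)) ⟩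
  not (at (μ^ n) n)             ≡⟨ cong not (t-at-μ^ n n (n<2^n n)) ⟨
  not (t n)                     ∎
  where open ≡-Reasoning
        double-bound : suc (n + n) < 2 ^ suc n
        double-bound = subst (suc (n + n) <_) (sym (2^-suc n)) (+-mono-≤-< (n<2^n n) (n<2^n n))

t-block-differs : ∀ w → t (suc (w + w)) ≢ t (w + w)
t-block-differs w eq = not-¬ (trans eq (t-even w)) (t-odd w)

no-letter-cube : ∀ x → t (suc x) ≡ t x → t (suc (suc x)) ≢ t (suc x)
no-letter-cube x eq₁ eq₂ with parity x
... | even w = t-block-differs w eq₁
... | odd w  = t-block-differs (suc w) (subst (λ y → t (suc y) ≡ t y) (cong suc (sym (+-suc w w))) eq₂)

PeriodicOn : ℕ → ℕ → ℕ → Set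
PeriodicOn p j L = ∀ d → d < L → t (j + d + p) ≡ t (j + d)

periodicOn-sub : ∀ p j {L} e L' → e + L' ≤ L → PeriodicOn p j L → PeriodicOn p (j + e) L'
periodicOn-sub p j e L' le per d d<L' =
  subst (λ x → t (x + p) ≡ t x) (sym (+-assoc j e d)) (per (e + d) (<-≤-trans (+-monoʳ-< e d<L') le))

periodicOn-prefix : ∀ p j {L} L' → L' ≤ L → PeriodicOn p j L → PeriodicOn p j L'
periodicOn-prefix p j L' le per d d<L' = per d (<-≤-trans d<L' le)

odd-period-descends : ∀ q z → PeriodicOn (suc (q + q)) (z + z) 2 → t (suc (z + q)) ≡ t (z + q)
odd-period-descends q z per = begin
  t (suc (z + q))                       ≡⟨ t-even (suc (z + q)) ⟨
  t (suc (z + q) + suc (z + q))         ≡⟨ cong t (second-position z q) ⟨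
  t (z + z + 1 + suc (q + q))           ≡⟨ per 1 (s≤s (s≤s z≤n)) ⟩
  t (z + z + 1)                         ≡⟨ cong t (+-comm (z + z) 1) ⟩
  t (suc (z + z))                       ≡⟨ t-odd z ⟩
  not (t z)                             ≡⟨ cong not (t-even z) ⟨
  not (t (z + z))                       ≡⟨ cong (λ x → not (t x)) (+-identityʳ (z + z)) ⟨
  not (t (z + z + 0))                   ≡⟨ cong not (per 0 z<s) ⟨
  not (t (z + z + 0 + suc (q + q)))     ≡⟨ cong (λ x → not (t x)) (first-position z q) ⟩
  not (t (suc ((z + q) + (z + q))))     ≡⟨ cong not (t-odd (z + q)) ⟩
  not (not (t (z + q)))                 ≡⟨ not-involutive (t (z + q)) ⟩
  t (z + q)                             ∎
  where
  open ≡-Reasoning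
  first-position : ∀ z q → z + z + 0 + suc (q + q) ≡ suc ((z + q) + (z + q))
  first-position = solve-∀
  second-position : ∀ z q → z + z + 1 + suc (q + q) ≡ suc (z + q) + suc (z + q)
  second-position = solve-∀

-- An odd period cannot persist over four letters starting at an even position:
-- it would give t(x) = t(x+1) = t(x+2) with x = z + q.
no-odd-period-aligned : ∀ q z → ¬ PeriodicOn (suc (q + q)) (z + z) 4
no-odd-period-aligned q z per = no-letter-cube (z + q) first second
  where
  first : t (suc (z + q)) ≡ t (z + q)
  first = odd-period-descends q z
    (periodicOn-prefix (suc (q + q)) (z + z) 2 (s≤s (s≤s z≤n)) per)
  second : t (suc (suc (z + q))) ≡ t (suc (z + q))
  second = odd-period-descends q (suc z)
    (subst (λ x → PeriodicOn (suc (q + q)) x 2) (trans (+-comm (z + z) 2) (cong suc (sym (+-suc z z)))) (periodicOn-sub (suc (q + q)) (z + z) 2 2 ≤-refl per))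

-- Any window of length 5 contains four letters starting at an even position,
-- so an odd period never persists over 5 letters.
no-odd-period : ∀ q j → ¬ PeriodicOn (suc (q + q)) j 5
no-odd-period q j per with roundUpEven j
... | z , e , e≤1 , j+e≡2z = no-odd-period-aligned q z
  (subst (λ x → PeriodicOn (suc (q + q)) x 4) j+e≡2z (periodicOn-sub (suc (q + q)) j e 4 (+-monoˡ-≤ 4 e≤1) per))

halve-period : ∀ q j L → PeriodicOn (q + q) j (L + L) → ∃ λ j' → PeriodicOn q j' L
halve-period q j L per with roundUpEven j
... | z , e , e≤1 , j+e≡2z = z , periodic
  where
  periodic : PeriodicOn q z L
  periodic d d<L = begin
    t (z + d + q)                         ≡⟨ t-even (z + d + q) ⟨
    t ((z + d + q) + (z + d + q))         ≡⟨ cong t (doubled-shift z d q) ⟨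
    t (z + z + (d + d) + (q + q))         ≡⟨ cong (λ x → t (x + (d + d) + (q + q))) j+e≡2z ⟨
    t (j + e + (d + d) + (q + q))         ≡⟨ cong (λ x → t (x + (q + q))) (+-assoc j e (d + d)) ⟩
    t (j + (e + (d + d)) + (q + q))       ≡⟨ per (e + (d + d)) (≤-<-trans (+-monoˡ-≤ (d + d) e≤1) odd<2L) ⟩
    t (j + (e + (d + d)))                 ≡⟨ cong t (+-assoc j e (d + d)) ⟨
    t (j + e + (d + d))                   ≡⟨ cong (λ x → t (x + (d + d))) j+e≡2z ⟩
    t (z + z + (d + d))                   ≡⟨ cong t (doubled-sum z d) ⟩
    t ((z + d) + (z + d))                 ≡⟨ t-even (z + d) ⟩
    t (z + d)                             ∎
    where
    open ≡-Reasoning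
    odd<2L : suc (d + d) < L + L
    odd<2L = subst (_≤ L + L) (cong suc (+-suc d d)) (+-mono-≤ d<L d<L)
    doubled-shift : ∀ z d q → z + z + (d + d) + (q + q) ≡ (z + d + q) + (z + d + q)
    doubled-shift = solve-∀
    doubled-sum : ∀ z d → z + z + (d + d) ≡ (z + d) + (z + d)
    doubled-sum = solve-∀

no-period : ∀ p → 0 < p → ∀ j → ¬ PeriodicOn p j (5 * p)
no-period = <-rec (λ p → 0 < p → ∀ j → ¬ PeriodicOn p j (5 * p)) step
  where
  step : ∀ p → (∀ {q} → q < p → 0 < q → ∀ j → ¬ PeriodicOn q j (5 * q)) →
         0 < p → ∀ j → ¬ PeriodicOn p j (5 * p)
  step p rec p>0 j per with parity p
  ... | odd q = no-odd-period q j
    (periodicOn-prefix (suc (q + q)) j 5 (*-monoʳ-≤ 5 p>0) per)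
  ... | even zero = contradiction p>0 λ ()
  ... | even (suc q) with halve-period (suc q) j (5 * suc q) (subst (PeriodicOn _ j) (*-distribˡ-+ 5 (suc q) (suc q)) per)
  ...   | j' , per' = rec (m<m+n (suc q) z<s) z<s j' per'

length-factorAt : ∀ x n → length (factorAt x n) ≡ n
length-factorAt x zero    = refl
length-factorAt x (suc n) = cong suc (length-factorAt (suc x) n)

take-factorAt : ∀ x l m → l ≤ m → take l (factorAt x m) ≡ factorAt x l
take-factorAt x zero    m       _        = refl
take-factorAt x (suc l) (suc m) (s≤s le) = cong (t x ∷_) (take-factorAt (suc x) l m le)

drop-factorAt : ∀ x j m → drop j (factorAt x m) ≡ factorAt (x + j) (m ∸ j)
drop-factorAt x zero    m       = cong (λ y → factorAt y m) (sym (+-identityʳ x))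
drop-factorAt x (suc j) zero    = refl
drop-factorAt x (suc j) (suc m) = trans (drop-factorAt (suc x) j m) (cong (λ y → factorAt y (m ∸ j)) (sym (+-suc x j)))

factorAt-letters : ∀ x y L → factorAt x L ≡ factorAt y L → ∀ d → d < L → t (x + d) ≡ t (y + d)
factorAt-letters x y (suc L) eq zero    _        =
  trans (cong t (+-identityʳ x)) (trans (proj₁ (∷-injective eq)) (cong t (sym (+-identityʳ y))))
factorAt-letters x y (suc L) eq (suc d) (s≤s lt) =
  trans (cong t (+-suc x d)) (trans (factorAt-letters (suc x) (suc y) L (proj₂ (∷-injective eq)) d lt) (cong t (sym (+-suc y d))))

factorAt-shift-differs : ∀ x p L → 0 < p → 5 * p ≤ L → factorAt x L ≢ factorAt (x + p) L
factorAt-shift-differs x p L p>0 5p≤L eq = no-period p p>0 x λ d d<5p →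
  trans (cong t (swap-last x d p)) (sym (factorAt-letters x (x + p) L eq d (<-≤-trans d<5p 5p≤L)))
  where
  swap-last : ∀ x d p → x + d + p ≡ x + p + d
  swap-last = solve-∀

occ-block : ∀ a b w → occ a (b ∷ not b ∷ w) ≡ suc (occ a w)
occ-block false false w = refl
occ-block false true  w = refl
occ-block true  false w = refl
occ-block true  true  w = refl

-- A factor at position 2y of length 2k is a product of k blocks 01 or 10,
-- so it contains each letter exactly k times.
occ-aligned : ∀ a y k → occ a (factorAt (y + y) (k + k)) ≡ k
occ-aligned a y zero    = refl
occ-aligned a y (suc k) rewrite +-suc k k | t-odd y | t-even y =
  trans (occ-block a (t y) (factorAt (suc (suc (y + y))) (k + k)))
        (cong suc (subst (λ x → occ a (factorAt x (k + k)) ≡ k) (+-suc (suc y) y) (occ-aligned a (suc y) k)))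

⌊⌋-true : ∀ {A : Set} (a? : Dec A) → A → ⌊ a? ⌋ ≡ true
⌊⌋-true a? a = trans (isYes≗does a?) (dec-true a? a)

anagram?-intro : ∀ u v → (∀ a → occ a u ≡ occ a v) → anagram? u v ≡ true
anagram?-intro u v balanced =
  cong₂ B._∧_ (⌊⌋-true (occ false u ≟ occ false v) (balanced false)) (⌊⌋-true (occ true u ≟ occ true v) (balanced true))

isAbSq-intro : ∀ w h → 0 < h → length w ≡ h * 2 →
               (∀ a → occ a (take h w) ≡ occ a (drop h w)) → isAbSq w ≡ true
isAbSq-intro w h h>0 len balanced with length w % 2 in parity-eq
... | suc _ = contradiction (trans (sym parity-eq) (trans (cong (_% 2) len) (m*n%n≡0 h 2))) λ ()
... | zero  = cong₂ B._∧_ (⌊⌋-true (1 ≤? length w) nonempty)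
  (subst (λ k → anagram? (take k w) (drop k w) ≡ true) (sym half) (anagram?-intro (take h w) (drop h w) balanced))
  where
  half : length w / 2 ≡ h
  half = trans (cong (_/ 2) len) (m*n/n≡m h 2)
  nonempty : 1 ≤ length w
  nonempty = subst (1 ≤_) (sym len) (≤-trans h>0 (m≤m*n h 2))

alignedSquare : ℕ → ℕ → Word
alignedSquare y k = factorAt (y + y) ((k + k) + (k + k))

-- Its halves are aligned factors of length 2k, so it is an abelian square.
alignedSquare-isAbSq : ∀ y k → 0 < k → isAbSq (alignedSquare y k) ≡ true
alignedSquare-isAbSq y k k>0 = isAbSq-intro (alignedSquare y k) (k + k) (≤-trans k>0 (m≤m+n k k))
  (trans (length-factorAt (y + y) _) (sym (double-twice k)))
  (λ a → begin
    occ a (take (k + k) (alignedSquare y k))   ≡⟨ cong (occ a) (take-factorAt (y + y) (k + k) _ (m≤m+n (k + k) (k + k))) ⟩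
    occ a (factorAt (y + y) (k + k))           ≡⟨ occ-aligned a y k ⟩
    k                                          ≡⟨ occ-aligned a (y + k) k ⟨
    occ a (factorAt ((y + k) + (y + k)) (k + k)) ≡⟨ cong (occ a) second-half ⟨
    occ a (drop (k + k) (alignedSquare y k))   ∎)
  where
  open ≡-Reasoning
  double-twice : ∀ k → (k + k) * 2 ≡ (k + k) + (k + k)
  double-twice = solve-∀
  shifted : ∀ y k → y + y + (k + k) ≡ (y + k) + (y + k)
  shifted = solve-∀
  second-half : drop (k + k) (alignedSquare y k) ≡ factorAt ((y + k) + (y + k)) (k + k)
  second-half = trans (drop-factorAt (y + y) (k + k) _) (cong₂ factorAt (shifted y k) (m+n∸m≡n (k + k) (k + k)))

take-drop-∈-factors : ∀ v j l → j + l ≤ length v → take l (drop j v) ∈ factors v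
take-drop-∈-factors v j l le =
  ∈-concatMap⁺ (λ j' → List.map (λ l' → take l' (drop j' v)) (List.upTo (suc (length v))))
    (lose {P = λ j' → take l (drop j v) ∈ List.map (λ l' → take l' (drop j' v)) (List.upTo (suc (length v)))}
      (∈-upTo⁺ (s≤s (m+n≤o⇒m≤o j le)))
      (∈-map⁺ (λ l' → take l' (drop j v)) (∈-upTo⁺ (s≤s (m+n≤o⇒n≤o j le)))))

factorAt-∈-factors : ∀ i n x l → i ≤ x → x + l ≤ i + n → factorAt x l ∈ factors (factorAt i n)
factorAt-∈-factors i n x l i≤x le = subst (_∈ factors (factorAt i n)) window-piece
  (take-drop-∈-factors (factorAt i n) (x ∸ i) l (subst (x ∸ i + l ≤_) (sym (length-factorAt i n)) fits))
  where
  i+[x∸i]≡x : i + (x ∸ i) ≡ x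
  i+[x∸i]≡x = m+[n∸m]≡n i≤x
  fits : x ∸ i + l ≤ n
  fits = +-cancelˡ-≤ i (x ∸ i + l) n (subst (_≤ i + n) (trans (cong (_+ l) (sym i+[x∸i]≡x)) (+-assoc i (x ∸ i) l)) le)
  window-piece : take l (drop (x ∸ i) (factorAt i n)) ≡ factorAt x l
  window-piece = begin
    take l (drop (x ∸ i) (factorAt i n))          ≡⟨ cong (take l) (drop-factorAt i (x ∸ i) n) ⟩
    take l (factorAt (i + (x ∸ i)) (n ∸ (x ∸ i))) ≡⟨ take-factorAt _ l _ (m+n≤o⇒m≤o∸n l (subst (_≤ n) (+-comm (x ∸ i) l) fits)) ⟩
    factorAt (i + (x ∸ i)) l                      ≡⟨ cong (λ y → factorAt y l) i+[x∸i]≡x ⟩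
    factorAt x l                                  ∎
    where open ≡-Reasoning

injection-≤-length : ∀ {A : Set} {N} (ys : List A) (h : Fin N → A) →
                     Injective _≡_ _≡_ h → (∀ r → h r ∈ ys) → N ≤ length ys
injection-≤-length ys h h-inj mem = injective⇒≤ {f = λ r → index (mem r)} λ {r} {r'} eq →
  h-inj (trans (lookup-index (mem r)) (trans (cong (lookup ys) eq) (sym (lookup-index (mem r')))))

AS-lower-bound : ∀ v {N} (h : Fin N → Word) → Injective _≡_ _≡_ h →
                 (∀ r → h r ∈ factors v) → (∀ r → isAbSq (h r) ≡ true) → N ≤ AS v
AS-lower-bound v h h-inj mem square = injection-≤-length _ h h-inj λ r →
  ∈-filter⁺ (λ w → isAbSq w B.≟ true) (∈-deduplicate⁺ (≡-dec B._≟_) (mem r)) (square r)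

grid : ∀ {A : Set} M → (ℕ → ℕ → A) → Fin (M * M) → A
grid M f r = f (toℕ (proj₁ (remQuot {M} M r))) (toℕ (proj₂ (remQuot {M} M r)))

grid-injective : ∀ {A : Set} M (f : ℕ → ℕ → A) →
  (∀ {a b a' b'} → a < M → b < M → a' < M → b' < M → f a b ≡ f a' b' → a ≡ a' × b ≡ b') →
  Injective _≡_ _≡_ (grid M f)
grid-injective M f f-inj {r} {r'} eq = begin
  r                                  ≡⟨ combine-remQuot {M} M r ⟨
  uncurry combine (remQuot {M} M r)  ≡⟨ cong (uncurry combine) same-pair ⟩
  uncurry combine (remQuot {M} M r') ≡⟨ combine-remQuot {M} M r' ⟩
  r'                                 ∎
  where
  open ≡-Reasoning
  same-coordinates : toℕ (proj₁ (remQuot {M} M r)) ≡ toℕ (proj₁ (remQuot {M} M r'))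
                   × toℕ (proj₂ (remQuot {M} M r)) ≡ toℕ (proj₂ (remQuot {M} M r'))
  same-coordinates = f-inj (toℕ<n _) (toℕ<n _) (toℕ<n _) (toℕ<n _) eq
  same-pair : remQuot {M} M r ≡ remQuot {M} M r'
  same-pair = cong₂ _,_ (toℕ-injective (proj₁ same-coordinates)) (toℕ-injective (proj₂ same-coordinates))

alignedSquare-shift-differs : ∀ y d k → 0 < d → 5 * d ≤ k + k → alignedSquare y k ≢ alignedSquare (y + d) k
alignedSquare-shift-differs y d k d>0 5d≤2k eq =
  factorAt-shift-differs (y + y) (d + d) ((k + k) + (k + k)) (≤-trans d>0 (m≤m+n d d)) 10d≤4k
    (trans eq (cong (λ x → factorAt x ((k + k) + (k + k))) (doubled y d)))
  where
  10d≤4k : 5 * (d + d) ≤ (k + k) + (k + k)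
  10d≤4k = subst (_≤ (k + k) + (k + k)) (sym (*-distribˡ-+ 5 d d)) (+-mono-≤ 5d≤2k 5d≤2k)
  doubled : ∀ y d → (y + d) + (y + d) ≡ (y + y) + (d + d)
  doubled = solve-∀

nearby-squares-differ : ∀ M z a a' k → a < a' → a' < M → 3 * M ≤ k →
                        alignedSquare (z + a) k ≢ alignedSquare (z + a') k
nearby-squares-differ M z a a' k a<a' a'<M 3M≤k eq =
  alignedSquare-shift-differs (z + a) (a' ∸ a) k (m<n⇒0<n∸m a<a') 5d≤2k
    (trans eq (cong (λ y → alignedSquare y k) z+a'≡z+a+d))
  where
  d≤M : a' ∸ a ≤ M
  d≤M = ≤-trans (m∸n≤m a' a) (<⇒≤ a'<M)
  5d≤2k : 5 * (a' ∸ a) ≤ k + k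
  5d≤2k = ≤-trans (*-monoʳ-≤ 5 d≤M)
          (≤-trans (*-monoˡ-≤ M (n≤1+n 5)) (subst (_≤ k + k) (sym (*-distribʳ-+ M 3 3)) (+-mono-≤ 3M≤k 3M≤k)))
  z+a'≡z+a+d : z + a' ≡ z + a + (a' ∸ a)
  z+a'≡z+a+d = trans (cong (z +_) (sym (m+[n∸m]≡n (<⇒≤ a<a')))) (sym (+-assoc z a (a' ∸ a)))

quadruple-injective : ∀ k k' → (k + k) + (k + k) ≡ (k' + k') + (k' + k') → k ≡ k'
quadruple-injective k k' eq = *-cancelˡ-≡ k k' 4 (trans (quadruple k) (trans eq (sym (quadruple k'))))
  where
  quadruple : ∀ k → 4 * k ≡ (k + k) + (k + k)
  quadruple = solve-∀

windowSquare : ℕ → ℕ → ℕ → ℕ → Word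
windowSquare M z a b = alignedSquare (z + a) (3 * M + b)

windowSquare-same-length : ∀ M z {a b a' b'} → windowSquare M z a b ≡ windowSquare M z a' b' → b ≡ b'
windowSquare-same-length M z {b = b} {b' = b'} eq = +-cancelˡ-≡ (3 * M) b b' (quadruple-injective _ _
  (trans (sym (length-factorAt _ _)) (trans (cong length eq) (length-factorAt _ _))))

windowSquare-injective : ∀ M z {a b a' b'} → a < M → b < M → a' < M → b' < M →
                         windowSquare M z a b ≡ windowSquare M z a' b' → a ≡ a' × b ≡ b'
windowSquare-injective M z {a} {b} {a'} a<M b<M a'<M b'<M eq with windowSquare-same-length M z eq
... | refl with <-cmp a a'
...   | tri< a<a' _ _ = contradiction eq (nearby-squares-differ M z a a' _ a<a' a'<M (m≤m+n (3 * M) b))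
...   | tri≈ _ a≡a' _ = a≡a' , refl
...   | tri> _ _ a'<a = contradiction (sym eq) (nearby-squares-differ M z a' a _ a'<a a<M (m≤m+n (3 * M) b))

windowSquare-∈ : ∀ i n M z a b → i ≤ z + z → z + z ≤ i + 1 → 0 < M → 20 * M ≤ n → a < M → b < M →
                 windowSquare M z a b ∈ factors (factorAt i n)
windowSquare-∈ i n M z a b i≤2z 2z≤i+1 M>0 20M≤n a<M b<M =
  factorAt-∈-factors i n _ _ (≤-trans i≤2z (+-mono-≤ (m≤m+n z a) (m≤m+n z a))) ends-in-window
  where
  open ≤-Reasoning
  a≤M : a ≤ M
  a≤M = <⇒≤ a<M
  k≤4M : 3 * M + b ≤ 3 * M + M
  k≤4M = +-monoʳ-≤ (3 * M) (<⇒≤ b<M)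
  spread : ∀ z M → ((z + M) + (z + M)) + (((3 * M + M) + (3 * M + M)) + ((3 * M + M) + (3 * M + M)))
                   ≡ (z + z) + 18 * M
  spread = solve-∀
  split-20 : ∀ M → 20 * M ≡ 2 * M + 18 * M
  split-20 = solve-∀
  1+18M≤n : 1 + 18 * M ≤ n
  1+18M≤n = ≤-trans (+-monoˡ-≤ (18 * M) (≤-trans (s≤s z≤n) (*-monoʳ-≤ 2 M>0)))
                    (subst (_≤ n) (split-20 M) 20M≤n)
  ends-in-window : (z + a) + (z + a) + ((3 * M + b + (3 * M + b)) + (3 * M + b + (3 * M + b))) ≤ i + n
  ends-in-window = begin
    (z + a) + (z + a) + ((3 * M + b + (3 * M + b)) + (3 * M + b + (3 * M + b)))
      ≤⟨ +-mono-≤ (+-mono-≤ (+-monoʳ-≤ z a≤M) (+-monoʳ-≤ z a≤M))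
                  (+-mono-≤ (+-mono-≤ k≤4M k≤4M) (+-mono-≤ k≤4M k≤4M)) ⟩
    ((z + M) + (z + M)) + (((3 * M + M) + (3 * M + M)) + ((3 * M + M) + (3 * M + M)))
      ≡⟨ spread z M ⟩
    (z + z) + 18 * M   ≤⟨ +-monoˡ-≤ (18 * M) 2z≤i+1 ⟩
    (i + 1) + 18 * M   ≡⟨ +-assoc i 1 (18 * M) ⟩
    i + (1 + 18 * M)   ≤⟨ +-monoʳ-≤ i 1+18M≤n ⟩
    i + n              ∎

AS-window-bound : ∀ i n M → 0 < M → 20 * M ≤ n → M * M ≤ AS (factorAt i n)
AS-window-bound i n M M>0 20M≤n with roundUpEven i
... | z , e , e≤1 , i+e≡2z = AS-lower-bound (factorAt i n) (grid M (windowSquare M z))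
  (grid-injective M (windowSquare M z) (windowSquare-injective M z))
  (λ r → windowSquare-∈ i n M z _ _ i≤2z 2z≤i+1 M>0 20M≤n (toℕ<n _) (toℕ<n _))
  (λ r → alignedSquare-isAbSq (z + toℕ (proj₁ (remQuot {M} M r))) _ (≤-trans (s≤s z≤n) (≤-trans (*-monoʳ-≤ 3 M>0) (m≤m+n (3 * M) _))))
  where
  i≤2z : i ≤ z + z
  i≤2z = subst (i ≤_) i+e≡2z (m≤m+n i e)
  2z≤i+1 : z + z ≤ i + 1
  2z≤i+1 = subst (_≤ i + 1) i+e≡2z (+-monoʳ-≤ i e≤1)

-- With M = ⌊n/20⌋ ≥ 1 we have n < 20M + 20 ≤ 40M.
n≤40⌊n/20⌋ : ∀ n → 20 ≤ n → n ≤ (n / 20) * 20 + (n / 20) * 20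
n≤40⌊n/20⌋ n 20≤n = subst (_≤ M * 20 + M * 20) (sym (m≡m%n+[m/n]*n n 20))
  (+-monoˡ-≤ (M * 20) (≤-trans (<⇒≤ (m%n<n n 20)) (*-monoˡ-≤ 20 (/-monoˡ-≤ 20 20≤n))))
  where
  M : ℕ
  M = n / 20

20⌊n/20⌋≤n : ∀ n → 20 * (n / 20) ≤ n
20⌊n/20⌋≤n n = subst (_≤ n) (*-comm (n / 20) 20)
  (subst ((n / 20) * 20 ≤_) (sym (m≡m%n+[m/n]*n n 20)) (m≤n+m ((n / 20) * 20) (n % 20)))

n²≤1600⌊n/20⌋² : ∀ n → 20 ≤ n → n ^ 2 ≤ 1600 * ((n / 20) * (n / 20))
n²≤1600⌊n/20⌋² n 20≤n = subst₂ _≤_ (sym (square n)) (doubled-square (n / 20)) (*-mono-≤ n≤ n≤)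
  where
  n≤ : n ≤ (n / 20) * 20 + (n / 20) * 20
  n≤ = n≤40⌊n/20⌋ n 20≤n
  square : ∀ n → n ^ 2 ≡ n * n
  square n = cong (n *_) (*-identityʳ n)
  doubled-square : ∀ M → (M * 20 + M * 20) * (M * 20 + M * 20) ≡ 1600 * (M * M)
  doubled-square = solve-∀

1/suc : ℕ → ℚ
1/suc c = mkℚ (ℤ.+ 1) c (1-coprimeTo (suc c))

1/suc-positive : ∀ c → 0ℚ Q.< 1/suc c
1/suc-positive c = Q.*<* (ℤ.+<+ (s≤s z≤n))

ℕ→ℚ-mkℚ : ∀ n → ℕ→ℚ n ≡ mkℚ (ℤ.+ n) 0 (coprime-sym (1-coprimeTo n))
ℕ→ℚ-mkℚ n = normalize-coprime (coprime-sym (1-coprimeTo n))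

scale-≤ : ∀ c n a → n ≤ suc c * a → 1/suc c Q.* ℕ→ℚ n Q.≤ ℕ→ℚ a
scale-≤ c n a le rewrite ℕ→ℚ-mkℚ n | ℕ→ℚ-mkℚ a =
  toℚᵘ-cancel-≤ (Qᵘₚ.≤-respˡ-≃ (Qᵘₚ.≃-sym (toℚᵘ-homo-* (1/suc c) n/1)) (Qᵘ.*≤* cross-multiplied))
  where
  n/1 : ℚ
  n/1 = mkℚ (ℤ.+ n) 0 (coprime-sym (1-coprimeTo n))
  -- Cross-multiplied, n/(c+1) ≤ a/1 is the hypothesis n ≤ a·(c+1) read in ℤ.
  cross-multiplied : (ℤ.+ 1 ℤ.* ℤ.+ n) ℤ.* ℤ.+ 1 ℤ.≤ ℤ.+ a ℤ.* ℤ.+ (suc c * 1)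
  cross-multiplied = subst₂ ℤ._≤_
    (sym (trans (ℤₚ.*-identityʳ (ℤ.+ 1 ℤ.* ℤ.+ n)) (ℤₚ.*-identityˡ (ℤ.+ n))))
    (ℤₚ.pos-* a (suc c * 1))
    (ℤ.+≤+ (subst (n ≤_) (trans (*-comm (suc c) a) (cong (a *_) (sym (*-identityʳ (suc c))))) le))

proposition8 : Σ ℚ λ C → Σ ℕ λ n₀ → (0ℚ Q.< C) ×
    ((v : Word) → IsFactorOfT v → length v ≥ n₀ →
      C Q.* ℕ→ℚ (length v ^ 2) Q.≤ ℕ→ℚ (AS v))
proposition8 = 1/suc 1599 , 20 , 1/suc-positive 1599 , bound
  where
  bound : (v : Word) → IsFactorOfT v → length v ≥ 20 → 1/suc 1599 Q.* ℕ→ℚ (length v ^ 2) Q.≤ ℕ→ℚ (AS v)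
  bound v (i , factorAt-i≡v) n≥20 = subst (λ w → 1/suc 1599 Q.* ℕ→ℚ (n ^ 2) Q.≤ ℕ→ℚ (AS w)) factorAt-i≡v
    (scale-≤ 1599 (n ^ 2) (AS (factorAt i n))
      (≤-trans (n²≤1600⌊n/20⌋² n n≥20)
               (*-monoʳ-≤ 1600 (AS-window-bound i n (n / 20) (/-monoˡ-≤ 20 n≥20) (20⌊n/20⌋≤n n)))))
    where
    n : ℕ
    n = length v
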